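{- Let $m,n$ be positive integers and let $G = P_n \mathbin{\Box} P_m$. If $H$ is a subgraph of $G$ that is either (a) a path joining two boundary vertices of $G$, or (b) a cycle in $G$, then $H$ is a $3$-forbidden subgraph of $G$; in particular, every $3$-percolating set of $G$ contains at least one vertex of $H$.
   Context: For a graph $G$ and an integer $r \ge 2$, the $r$-neighbor bootstrap percolation process starting from a set $A_0 \subseteq V(G)$ is defined by $A_t = A_{t-1} \cup \{ v \in V(G) : |N_G(v) \cap A_{t-1}| \ge r\}$ for $t \ge 1$, and $A_0$ is $r$-percolating if $\bigcup_{t \ge 0} A_t = V(G)$. A subgraph $H$ of $G$ is an $r$-forbidden subgraph of $G$ if every vertex of $H$ has strictly fewer than $r$ neighbors in $G$ belonging to $V(G)\setminus V(H)$. $P_n \mathbin{\Box} P_m$ is the Cartesian product of paths (the $n\times m$ grid); a vertex of the grid is a boundary vertex if its degree is at most $3$. -}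

module Defs where

open import Data.Nat using (ℕ; zero; suc; _≤_; _<_; _≡ᵇ_; _≤ᵇ_)
open import Data.Fin using (Fin; toℕ)
open import Data.Bool using (Bool; true; false; _∧_; _∨_; not; T; if_then_else_)
open import Data.List using (List; []; _∷_; _++_; [_]; length; allFin; cartesianProduct; filter; map)
open import Data.Nat.ListAction using (sum)
open import Data.Bool.ListAction using (any)
open import Data.Product using (_×_; _,_; Σ; ∃; proj₁; proj₂)
open import Data.List.Relation.Unary.Unique.Propositional using (Unique)
open import Data.List.Relation.Unary.Linked using (Linked)
open import Relation.Binary.PropositionalEquality using (_≡_)
open import Function using (_∘_)

V : ℕ → ℕ → Set
V n m = Fin n × Fin m

allV : (n m : ℕ) → List (V n m)
allV n m = cartesianProduct (allFin n) (allFin m)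

dist1 : ℕ → ℕ → Bool
dist1 a b = (suc a ≡ᵇ b) ∨ (suc b ≡ᵇ a)

adjB : ∀ {n m} → V n m → V n m → Bool
adjB (i , j) (i' , j') =
  ((toℕ i ≡ᵇ toℕ i') ∧ dist1 (toℕ j) (toℕ j')) ∨ ((toℕ j ≡ᵇ toℕ j') ∧ dist1 (toℕ i) (toℕ i'))

Adj : ∀ {n m} → V n m → V n m → Set
Adj u v = T (adjB u v)

eqV : ∀ {n m} → V n m → V n m → Bool
eqV (i , j) (i' , j') = (toℕ i ≡ᵇ toℕ i') ∧ (toℕ j ≡ᵇ toℕ j')

countV : ∀ n m → (V n m → Bool) → ℕ
countV n m P = sum (map (λ u → if P u then 1 else 0) (allV n m))

VSet : ℕ → ℕ → Set
VSet n m = V n m → Bool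

nbrsIn : ∀ {n m} → VSet n m → V n m → ℕ
nbrsIn {n} {m} S v = countV n m (λ u → adjB v u ∧ S u)

degree : ∀ {n m} → V n m → ℕ
degree {n} {m} v = countV n m (adjB v)

Boundary : ∀ {n m} → V n m → Set
Boundary v = degree v ≤ 3

step : ∀ {n m} → ℕ → VSet n m → VSet n m
step r A v = A v ∨ (r ≤ᵇ nbrsIn A v)

A-at : ∀ {n m} → ℕ → VSet n m → ℕ → VSet n m
A-at r A₀ zero = A₀
A-at r A₀ (suc t) = step r (A-at r A₀ t)

Percolating : ∀ {n m} → ℕ → VSet n m → Set
Percolating {n} {m} r A₀ = (v : V n m) → ∃ λ t → T (A-at r A₀ t v)

vset : ∀ {n m} → List (V n m) → VSet n m
vset p v = any (eqV v) p

Forbidden : ∀ {n m} → ℕ → VSet n m → Set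
Forbidden {n} {m} r H = (v : V n m) → T (H v) → nbrsIn (not ∘ H) v < r

IsBoundaryPath : ∀ {n m} → List (V n m) → Set
IsBoundaryPath {n} {m} p =
  Unique p × Linked Adj p ×
  Σ (V n m) λ u → Σ (List (V n m)) λ mid → Σ (V n m) λ w →
    (p ≡ u ∷ (mid ++ [ w ])) × Boundary u × Boundary w

IsCycle : ∀ {n m} → List (V n m) → Set
IsCycle {n} {m} p =
  Unique p × Linked Adj p × (3 ≤ length p) ×
  Σ (V n m) λ u → Σ (List (V n m)) λ mid → Σ (V n m) λ w →
    (p ≡ u ∷ (mid ++ [ w ])) × Adj w u

module Submission where

-- Every vertex of a boundary path or cycle H either is an endpoint, hence a boundary vertex (degree ≤ 3)
-- with a neighbour on H, or has two distinct neighbours on H out of at most four; either way at most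
-- two of its neighbours lie off H, so H is 3-forbidden. Then no vertex of H ever sees three infected
-- neighbours, so H stays uninfected unless the initial set meets it, and a percolating set must meet H.

open import Defs
open import Data.Bool using (Bool; true; false; T; _∧_; _∨_; not; if_then_else_)
open import Data.Bool.Properties using (T-∧; T-∨; ∧-distribˡ-∨; ∨-comm)
open import Data.Empty using (⊥-elim)
open import Data.Fin using (toℕ)
open import Data.Fin.Properties using (toℕ-injective)
open import Data.List using (List; []; _∷_; _++_; [_]; map)
open import Data.List.Membership.Propositional using (_∈_; find; lose)
open import Data.List.Membership.Propositional.Properties using (∈-++⁺ˡ; ∈-++⁺ʳ; ∈-++⁻; ∈-allFin; ∈-cartesianProduct⁺)
open import Data.List.Relation.Unary.All using (_∷_) renaming (lookup to All-lookup)
open import Data.List.Relation.Unary.AllPairs using (_∷_)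
open import Data.List.Relation.Unary.Any using (here; there; any?) renaming (map to Any-map)
open import Data.List.Relation.Unary.Any.Properties using (any⁺; any⁻)
open import Data.List.Relation.Unary.Linked using (Linked; [-]; _∷_)
open import Data.List.Relation.Unary.Unique.Propositional using (Unique)
open import Data.List.Relation.Unary.Unique.Propositional.Properties using (allFin⁺; cartesianProduct⁺)
open import Data.Nat using (ℕ; zero; suc; pred; _+_; _≤_; _≡ᵇ_; z≤n; s≤s)
open import Data.Nat.ListAction using (sum)
open import Data.Nat.Properties
  using (≡ᵇ⇒≡; ≡⇒≡ᵇ; ≤ᵇ⇒≤; ≤-reflexive; ≤-trans; m≤n⇒m≤1+n; n≤1+n; <⇒≱; +-suc; +-mono-≤; +-monoʳ-≤; +-cancelʳ-≤; module ≤-Reasoning)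
open import Data.Product using (_×_; _,_; proj₁; proj₂; ∃)
open import Data.Sum using (_⊎_; inj₁; inj₂)
open import Function using (_∘_; Equivalence)
open import Relation.Nullary using (¬_; yes; no)
open import Relation.Nullary.Decidable using (T?)
open import Relation.Binary.PropositionalEquality using (_≡_; _≢_; refl; sym; trans; cong; cong₂; subst)

module _ {A : Set} where

  countIf : (A → Bool) → List A → ℕ
  countIf P xs = sum (map (λ x → if P x then 1 else 0) xs)

  countIf-mono : ∀ {P Q : A → Bool} xs → (∀ x → T (P x) → T (Q x)) → countIf P xs ≤ countIf Q xs
  countIf-mono [] _ = z≤n
  countIf-mono {P} {Q} (x ∷ xs) P⇒Q with P x in px | Q x in qx
  ... | true  | true  = s≤s (countIf-mono xs P⇒Q)
  ... | false | true  = m≤n⇒m≤1+n (countIf-mono xs P⇒Q)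
  ... | false | false = countIf-mono xs P⇒Q
  ... | true  | false = ⊥-elim (subst T qx (P⇒Q x (subst T (sym px) _)))

  countIf-∨ : ∀ (P Q : A → Bool) xs → countIf (λ x → P x ∨ Q x) xs ≤ countIf P xs + countIf Q xs
  countIf-∨ P Q [] = z≤n
  countIf-∨ P Q (x ∷ xs) with P x | Q x
  ... | true  | true  = s≤s (≤-trans (countIf-∨ P Q xs) (+-monoʳ-≤ (countIf P xs) (n≤1+n _)))
  ... | true  | false = s≤s (countIf-∨ P Q xs)
  ... | false | true  =
    ≤-trans (s≤s (countIf-∨ P Q xs)) (≤-reflexive (sym (+-suc (countIf P xs) (countIf Q xs))))
  ... | false | false = countIf-∨ P Q xs

  countIf-partition : ∀ (P Q : A → Bool) xs →
    countIf (λ x → P x ∧ not (Q x)) xs + countIf (λ x → P x ∧ Q x) xs ≡ countIf P xs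
  countIf-partition P Q [] = refl
  countIf-partition P Q (x ∷ xs) with P x | Q x
  ... | true  | true  = trans (+-suc _ _) (cong suc (countIf-partition P Q xs))
  ... | true  | false = cong suc (countIf-partition P Q xs)
  ... | false | _     = countIf-partition P Q xs

  countIf-none : ∀ (P : A → Bool) xs → (∀ {x} → x ∈ xs → ¬ T (P x)) → countIf P xs ≡ 0
  countIf-none P [] _ = refl
  countIf-none P (x ∷ xs) ¬P with P x in px
  ... | true  = ⊥-elim (¬P (here refl) (subst T (sym px) _))
  ... | false = countIf-none P xs (¬P ∘ there)

  countIf-≤1 : ∀ (P : A → Bool) {xs} → Unique xs → (∀ {x y} → T (P x) → T (P y) → x ≡ y) → countIf P xs ≤ 1
  countIf-≤1 P {[]} _ _ = z≤n
  countIf-≤1 P {x ∷ xs} (x∉xs ∷ uniq) P-unique with P x in px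
  ... | true  = s≤s (≤-reflexive (countIf-none P xs λ y∈xs Py →
                  All-lookup x∉xs y∈xs (P-unique (subst T (sym px) _) Py)))
  ... | false = countIf-≤1 P uniq P-unique

  countIf-≥1 : ∀ (P : A → Bool) {x xs} → x ∈ xs → T (P x) → 1 ≤ countIf P xs
  countIf-≥1 P {xs = y ∷ _} (here refl) Px with P y
  ... | true = s≤s z≤n
  countIf-≥1 P {xs = y ∷ _} (there x∈xs) Px with P y
  ... | true  = s≤s z≤n
  ... | false = countIf-≥1 P x∈xs Px

  countIf-≥2 : ∀ (P : A → Bool) {x z xs} → x ∈ xs → z ∈ xs → x ≢ z → T (P x) → T (P z) → 2 ≤ countIf P xs
  countIf-≥2 P (here refl) (here refl) x≢z _ _ = ⊥-elim (x≢z refl)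
  countIf-≥2 P {xs = y ∷ _} (here refl) (there z∈xs) _ Px Pz with P y
  ... | true = s≤s (countIf-≥1 P z∈xs Pz)
  countIf-≥2 P {xs = y ∷ _} (there x∈xs) (here refl) _ Px Pz with P y
  ... | true = s≤s (countIf-≥1 P x∈xs Px)
  countIf-≥2 P {xs = y ∷ _} (there x∈xs) (there z∈xs) x≢z Px Pz with P y
  ... | true  = m≤n⇒m≤1+n (countIf-≥2 P x∈xs z∈xs x≢z Px Pz)
  ... | false = countIf-≥2 P x∈xs z∈xs x≢z Px Pz

≡ᵇ-comm : ∀ a b → (a ≡ᵇ b) ≡ (b ≡ᵇ a)
≡ᵇ-comm zero    zero    = refl
≡ᵇ-comm zero    (suc b) = refl
≡ᵇ-comm (suc a) zero    = refl
≡ᵇ-comm (suc a) (suc b) = ≡ᵇ-comm a b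

≡ᵇ∧≡ᵇ⇒≡×≡ : ∀ a b c d → T ((a ≡ᵇ b) ∧ (c ≡ᵇ d)) → a ≡ b × c ≡ d
≡ᵇ∧≡ᵇ⇒≡×≡ a b c d t =
  let (e₁ , e₂) = Equivalence.to (T-∧ {a ≡ᵇ b} {c ≡ᵇ d}) t in ≡ᵇ⇒≡ a b e₁ , ≡ᵇ⇒≡ c d e₂

allV-unique : ∀ n m → Unique (allV n m)
allV-unique n m = cartesianProduct⁺ (allFin⁺ n) (allFin⁺ m)

∈-allV : ∀ {n m} (v : V n m) → v ∈ allV n m
∈-allV (i , j) = ∈-cartesianProduct⁺ (∈-allFin i) (∈-allFin j)

countV-pinned : ∀ {n m} (P : V n m → Bool) {a b : ℕ} →
  (∀ {u} → T (P u) → toℕ (proj₁ u) ≡ a × toℕ (proj₂ u) ≡ b) → countV n m P ≤ 1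
countV-pinned P pin = countIf-≤1 P (allV-unique _ _) λ Pu Pw →
  let (u₁ , u₂) = pin Pu ; (w₁ , w₂) = pin Pw
  in cong₂ _,_ (toℕ-injective (trans u₁ (sym w₁))) (toℕ-injective (trans u₂ (sym w₂)))

-- Each of the four directions pins down the neighbour, so there are at most four.
degree-≤4 : ∀ {n m} (v : V n m) → degree v ≤ 4
degree-≤4 {n} {m} (i , j) = begin
  degree (i , j)
    ≤⟨ countIf-mono (allV n m) distribute ⟩
  countIf (λ u → (R u ∨ L u) ∨ (D u ∨ U u)) (allV n m)
    ≤⟨ countIf-∨ (λ u → R u ∨ L u) (λ u → D u ∨ U u) (allV n m) ⟩
  countIf (λ u → R u ∨ L u) (allV n m) + countIf (λ u → D u ∨ U u) (allV n m)
    ≤⟨ +-mono-≤ (countIf-∨ R L (allV n m)) (countIf-∨ D U (allV n m)) ⟩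
  (countV n m R + countV n m L) + (countV n m D + countV n m U)
    ≤⟨ +-mono-≤ (+-mono-≤ (countV-pinned R R-pin) (countV-pinned L L-pin))
                (+-mono-≤ (countV-pinned D D-pin) (countV-pinned U U-pin)) ⟩
  4 ∎
  where
  open ≤-Reasoning
  R L D U : V n m → Bool
  R (i' , j') = (toℕ i ≡ᵇ toℕ i') ∧ (suc (toℕ j) ≡ᵇ toℕ j')
  L (i' , j') = (toℕ i ≡ᵇ toℕ i') ∧ (suc (toℕ j') ≡ᵇ toℕ j)
  D (i' , j') = (toℕ j ≡ᵇ toℕ j') ∧ (suc (toℕ i) ≡ᵇ toℕ i')
  U (i' , j') = (toℕ j ≡ᵇ toℕ j') ∧ (suc (toℕ i') ≡ᵇ toℕ i)

  distribute : ∀ u → T (adjB (i , j) u) → T ((R u ∨ L u) ∨ (D u ∨ U u))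
  distribute (i' , j') = subst T (cong₂ _∨_
    (∧-distribˡ-∨ (toℕ i ≡ᵇ toℕ i') (suc (toℕ j) ≡ᵇ toℕ j') (suc (toℕ j') ≡ᵇ toℕ j))
    (∧-distribˡ-∨ (toℕ j ≡ᵇ toℕ j') (suc (toℕ i) ≡ᵇ toℕ i') (suc (toℕ i') ≡ᵇ toℕ i)))

  R-pin : ∀ {u} → T (R u) → toℕ (proj₁ u) ≡ toℕ i × toℕ (proj₂ u) ≡ suc (toℕ j)
  R-pin {i' , j'} t =
    let (e₁ , e₂) = ≡ᵇ∧≡ᵇ⇒≡×≡ (toℕ i) (toℕ i') (suc (toℕ j)) (toℕ j') t in sym e₁ , sym e₂

  L-pin : ∀ {u} → T (L u) → toℕ (proj₁ u) ≡ toℕ i × toℕ (proj₂ u) ≡ pred (toℕ j)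
  L-pin {i' , j'} t =
    let (e₁ , e₂) = ≡ᵇ∧≡ᵇ⇒≡×≡ (toℕ i) (toℕ i') (suc (toℕ j')) (toℕ j) t in sym e₁ , cong pred e₂

  D-pin : ∀ {u} → T (D u) → toℕ (proj₁ u) ≡ suc (toℕ i) × toℕ (proj₂ u) ≡ toℕ j
  D-pin {i' , j'} t =
    let (e₁ , e₂) = ≡ᵇ∧≡ᵇ⇒≡×≡ (toℕ j) (toℕ j') (suc (toℕ i)) (toℕ i') t in sym e₂ , sym e₁

  U-pin : ∀ {u} → T (U u) → toℕ (proj₁ u) ≡ pred (toℕ i) × toℕ (proj₂ u) ≡ toℕ j
  U-pin {i' , j'} t =
    let (e₁ , e₂) = ≡ᵇ∧≡ᵇ⇒≡×≡ (toℕ j) (toℕ j') (suc (toℕ i')) (toℕ i) t in cong pred e₂ , sym e₁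

dist1-comm : ∀ a b → dist1 a b ≡ dist1 b a
dist1-comm a b = ∨-comm (suc a ≡ᵇ b) (suc b ≡ᵇ a)

Adj-sym : ∀ {n m} (u v : V n m) → Adj u v → Adj v u
Adj-sym (i , j) (i' , j') = subst T (cong₂ _∨_
  (cong₂ _∧_ (≡ᵇ-comm (toℕ i) (toℕ i')) (dist1-comm (toℕ j) (toℕ j')))
  (cong₂ _∧_ (≡ᵇ-comm (toℕ j) (toℕ j')) (dist1-comm (toℕ i) (toℕ i'))))

eqV-refl : ∀ {n m} (v : V n m) → T (eqV v v)
eqV-refl (i , j) = Equivalence.from T-∧ (≡⇒≡ᵇ (toℕ i) (toℕ i) refl , ≡⇒≡ᵇ (toℕ j) (toℕ j) refl)

eqV⇒≡ : ∀ {n m} (v w : V n m) → T (eqV v w) → v ≡ w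
eqV⇒≡ (i , j) (i' , j') t =
  let (e₁ , e₂) = ≡ᵇ∧≡ᵇ⇒≡×≡ (toℕ i) (toℕ i') (toℕ j) (toℕ j') t
  in cong₂ _,_ (toℕ-injective e₁) (toℕ-injective e₂)

∈⇒vset : ∀ {n m} {p : List (V n m)} {v} → v ∈ p → T (vset p v)
∈⇒vset {v = v} v∈p = any⁺ (eqV v) (Any-map (λ { refl → eqV-refl v }) v∈p)

vset⇒∈ : ∀ {n m} (p : List (V n m)) v → T (vset p v) → v ∈ p
vset⇒∈ p v t = Any-map (eqV⇒≡ v _) (any⁻ (eqV v) p t)

module _ {n m : ℕ} where

  data Attached (v : V n m) (p : List (V n m)) : Set where
    boundary      : ∀ {a} → Boundary v → a ∈ p → Adj v a → Attached v p
    twoNeighbours : ∀ {a b} → a ∈ p → b ∈ p → a ≢ b → Adj v a → Adj v b → Attached v p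

  Attached-there : ∀ {v x p} → Attached v p → Attached v (x ∷ p)
  Attached-there (boundary ∂v a∈ va)                = boundary ∂v (there a∈) va
  Attached-there (twoNeighbours a∈ b∈ a≢b va vb) = twoNeighbours (there a∈) (there b∈) a≢b va vb

  first-neighbour : ∀ u mid (w : V n m) → Linked Adj (u ∷ mid ++ [ w ]) → ∃ λ b → b ∈ mid ++ [ w ] × Adj u b
  first-neighbour u []      w (uw ∷ _) = w , here refl , uw
  first-neighbour u (x ∷ _) w (ux ∷ _) = x , here refl , ux

  last-neighbour : ∀ u mid (w : V n m) → Linked Adj (u ∷ mid ++ [ w ]) → ∃ λ b → b ∈ u ∷ mid × Adj w b
  last-neighbour u []        w (uw ∷ _)      = u , here refl , Adj-sym u w uw
  last-neighbour u (x ∷ mid) w (_ ∷ linked) =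
    let (b , b∈ , wb) = last-neighbour x mid w linked in b , there b∈ , wb

  inner-attached : ∀ u mid (w : V n m) → Linked Adj (u ∷ mid ++ [ w ]) → Unique (u ∷ mid ++ [ w ]) →
    ∀ {v} → v ∈ mid → Attached v (u ∷ mid ++ [ w ])
  inner-attached u (x ∷ []) w (ux ∷ xw ∷ [-]) ((_ ∷ u≢w ∷ _) ∷ _) (here refl) =
    twoNeighbours (here refl) (there (there (here refl))) u≢w (Adj-sym u x ux) xw
  inner-attached u (x ∷ y ∷ _) w (ux ∷ xy ∷ _) ((_ ∷ u≢y ∷ _) ∷ _) (here refl) =
    twoNeighbours (here refl) (there (there (here refl))) u≢y (Adj-sym u x ux) xy
  inner-attached u (x ∷ mid) w (_ ∷ linked) (_ ∷ uniq) (there v∈mid) =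
    Attached-there (inner-attached x mid w linked uniq v∈mid)

  boundaryPath-attached : ∀ {p : List (V n m)} → IsBoundaryPath p → ∀ {v} → v ∈ p → Attached v p
  boundaryPath-attached (_ , linked , u , mid , w , refl , ∂u , _) (here refl) =
    let (_ , b∈ , ub) = first-neighbour u mid w linked in boundary ∂u (there b∈) ub
  boundaryPath-attached (uniq , linked , u , mid , w , refl , _ , ∂w) (there v∈) with ∈-++⁻ mid v∈
  ... | inj₁ v∈mid       = inner-attached u mid w linked uniq v∈mid
  ... | inj₂ (here refl) =
    let (_ , b∈ , wb) = last-neighbour u mid w linked in boundary ∂w (∈-++⁺ˡ b∈) wb

  cycle-attached : ∀ {p : List (V n m)} → IsCycle p → ∀ {v} → v ∈ p → Attached v p
  cycle-attached (_ , _ , s≤s (s≤s ()) , _ , [] , _ , refl , _)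
  cycle-attached (_ ∷ x∉ ∷ _ , ux ∷ _ , _ , u , x ∷ mid , w , refl , wu) (here refl) =
    twoNeighbours (there (here refl)) (∈-++⁺ʳ (u ∷ x ∷ mid) (here refl))
      (All-lookup x∉ (∈-++⁺ʳ mid (here refl))) ux (Adj-sym w u wu)
  cycle-attached (uniq@(u∉ ∷ _) , linked@(_ ∷ linked′) , _ , u , x ∷ mid , w , refl , wu) (there v∈)
    with ∈-++⁻ (x ∷ mid) v∈
  ... | inj₁ v∈mid = inner-attached u (x ∷ mid) w linked uniq v∈mid
  ... | inj₂ (here refl) =
    let (_ , b∈ , wb) = last-neighbour x mid w linked′
    in twoNeighbours (there (∈-++⁺ˡ b∈)) (here refl) (λ { refl → All-lookup u∉ (∈-++⁺ˡ b∈) refl }) wb wu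

  neighbourIn : ∀ {v a : V n m} {p} → Adj v a → a ∈ p → T (adjB v a ∧ vset p a)
  neighbourIn {v} {a} va a∈ = Equivalence.from (T-∧ {adjB v a}) (va , ∈⇒vset a∈)

  degree-≤-2+nbrsIn : ∀ {v : V n m} {p} → Attached v p → degree v ≤ 2 + nbrsIn (vset p) v
  degree-≤-2+nbrsIn {v} (boundary {a} ∂v a∈ va) =
    ≤-trans ∂v (+-monoʳ-≤ 2 (countIf-≥1 _ (∈-allV a) (neighbourIn {v} va a∈)))
  degree-≤-2+nbrsIn {v} (twoNeighbours {a} {b} a∈ b∈ a≢b va vb) =
    ≤-trans (degree-≤4 v) (+-monoʳ-≤ 2
      (countIf-≥2 _ (∈-allV a) (∈-allV b) a≢b (neighbourIn {v} va a∈) (neighbourIn {v} vb b∈)))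

  attached⇒nbrsOutside-≤2 : ∀ {v : V n m} {p} → Attached v p → nbrsIn (not ∘ vset p) v ≤ 2
  attached⇒nbrsOutside-≤2 {v} {p} att = +-cancelʳ-≤ (nbrsIn (vset p) v) _ 2 (begin
    nbrsIn (not ∘ vset p) v + nbrsIn (vset p) v ≡⟨ countIf-partition (adjB v) (vset p) (allV n m) ⟩
    degree v                                    ≤⟨ degree-≤-2+nbrsIn att ⟩
    2 + nbrsIn (vset p) v                       ∎)
    where open ≤-Reasoning

  pathOrCycle-forbidden : ∀ {p : List (V n m)} → IsBoundaryPath p ⊎ IsCycle p → Forbidden 3 (vset p)
  pathOrCycle-forbidden {p} H v v∈H = s≤s (attached⇒nbrsOutside-≤2 (attached H (vset⇒∈ p v v∈H)))
    where
    attached : IsBoundaryPath p ⊎ IsCycle p → ∀ {v} → v ∈ p → Attached v p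
    attached (inj₁ path)  = boundaryPath-attached path
    attached (inj₂ cycle) = cycle-attached cycle

  pathOrCycle-nonempty : ∀ {p : List (V n m)} → IsBoundaryPath p ⊎ IsCycle p → ∃ λ v → v ∈ p
  pathOrCycle-nonempty (inj₁ (_ , _ , u , _ , _ , refl , _))     = u , here refl
  pathOrCycle-nonempty (inj₂ (_ , _ , _ , u , _ , _ , refl , _)) = u , here refl

  nbrsIn-mono : ∀ {S S′ : VSet n m} → (∀ u → T (S u) → T (S′ u)) → ∀ v → nbrsIn S v ≤ nbrsIn S′ v
  nbrsIn-mono {S} {S′} S⊆S′ v = countIf-mono (allV n m) λ u t →
    let (vu , Su) = Equivalence.to (T-∧ {adjB v u} {S u}) t
    in Equivalence.from (T-∧ {adjB v u}) (vu , S⊆S′ u Su)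

  forbidden-stays-uninfected : ∀ {r} {H A₀ : VSet n m} → Forbidden r H → (∀ v → T (H v) → ¬ T (A₀ v)) →
    ∀ t v → T (H v) → ¬ T (A-at r A₀ t v)
  forbidden-stays-uninfected forb disjoint zero = disjoint
  forbidden-stays-uninfected {r} {H} {A₀} forb disjoint (suc t) v v∈H infected
    with Equivalence.to (T-∨ {A-at r A₀ t v}) infected
  ... | inj₁ was-infected = forbidden-stays-uninfected forb disjoint t v v∈H was-infected
  ... | inj₂ r≤nbrs = <⇒≱ (forb v v∈H) (≤-trans (≤ᵇ⇒≤ r _ r≤nbrs) (nbrsIn-mono Aₜ⊆∁H v))
    where
    Aₜ⊆∁H : ∀ u → T (A-at r A₀ t u) → T (not (H u))
    Aₜ⊆∁H u Aₜu with H u in u∈H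
    ... | true  = ⊥-elim (forbidden-stays-uninfected forb disjoint t u (subst T (sym u∈H) _) Aₜu)
    ... | false = _

  percolating-meets-forbidden : ∀ {r} {A : VSet n m} {p : List (V n m)} {v} →
    Forbidden r (vset p) → v ∈ p → Percolating r A → ∃ λ w → w ∈ p × T (A w)
  percolating-meets-forbidden {A = A} {p} {v} forb v∈p perc with any? (T? ∘ A) p
  ... | yes hit  = find hit
  ... | no  miss =
    let (t , infected) = perc v
    in ⊥-elim (forbidden-stays-uninfected forb disjoint t v (∈⇒vset v∈p) infected)
    where
    disjoint : ∀ w → T (vset p w) → ¬ T (A w)
    disjoint w w∈p Aw = miss (lose (vset⇒∈ p w w∈p) Aw)

corollary1 : (n m : ℕ) → 1 ≤ n → 1 ≤ m → (p : List (V n m)) →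
    (IsBoundaryPath p ⊎ IsCycle p) →
    Forbidden 3 (vset p) × ((A : VSet n m) → Percolating 3 A → ∃ λ v → v ∈ p × T (A v))
corollary1 n m _ _ p H =
  let forb = pathOrCycle-forbidden H
      (_ , v∈p) = pathOrCycle-nonempty H
  in forb , λ A → percolating-meets-forbidden forb v∈p
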